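{- Let $n\ge1$, let $w\in\mathcal{M}(A_{n-1})$ with level vector $(\beta_1,\ldots,\beta_n)$, and let $k\in\mathbb{Z}$. Then the antisymmetric expansion $\alpha(w_{[k]})=[\bar w(1),\ldots,\bar w(2n)]$ of the $k$-shift of $w$ is the base window of an element $\bar w\in\mathcal{M}(A_{2n-1})$, and the abacus diagram of $\bar w$ is balanced.
   Context: For $N\ge1$, base-level notation with respect to $N$: $a=r^{\ell}$ means $a=r+N\ell$ with $r\in\{1,\ldots,N\}$, $\ell\in\mathbb{Z}$. $\widetilde A_{N-1}$ is the group of bijections $w:\mathbb{Z}\to\mathbb{Z}$ with $w(x+N)=w(x)+N$ and $\sum_{i=1}^N w(i)=\binom{N+1}{2}$; $\mathcal{M}(A_{N-1})$ is the set of such $w$ with $w(1)<\cdots<w(N)$ (minimal length coset representatives of $\widetilde A_{N-1}/A_{N-1}$). The abacus of $w$ is $[w(1),\ldots,w(N)]$ written in base-level notation w.r.t. $N$; the level vector $(\beta_1,\ldots,\beta_N)$ has $\beta_i$ = level of the entry with base $i$. The $k$-shift of $w\in\mathcal{M}(A_{n-1})$ is $w_{[k]}=(w(1)+k,\ldots,w(n)+k)$, written in base-level notation w.r.t. $n$ as $[r_1^{a_1},\ldots,r_n^{a_n}]$ (so $\{r_1,\ldots,r_n\}=\{1,\ldots,n\}$). Its antisymmetric expansion $\alpha(w_{[k]})$ is the increasing arrangement $[\bar w(1)<\cdots<\bar w(2n)]$ of the $2n$ integers $r_i+2na_i$ and $(2n+1-r_i)-2na_i$, $1\le i\le n$. An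 abacus $[r_1^{\ell_1},\ldots,r_{2n}^{\ell_{2n}}]$ (w.r.t. $2n$) is balanced if it equals $[r_1^{\ell_1},\ldots,r_n^{\ell_n},r_{n+1}^{ -\ell_n},\ldots,r_{2n}^{ -\ell_1}]$ with $r_i+r_{2n+1-i}=2n+1$ for $1\le i\le n$. -}

module Defs where

open import Data.Nat as ℕ using (ℕ; suc; NonZero)
open import Data.Nat.Combinatorics using (_C_)
open import Data.Integer as ℤ using (ℤ; +_; _+_; _-_; _*_; -_; _<_; 0ℤ)
open import Data.Integer.DivMod using (_/ℕ_; _%ℕ_)
open import Data.Integer.Properties using (≤-decTotalOrder)
open import Data.List using (List; []; _∷_; foldr; applyUpTo; concat)
open import Data.Product using (_×_)
open import Function.Definitions using (Bijective)
open import Relation.Binary.PropositionalEquality using (_≡_)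
import Data.List.Sort

module ℤSort = Data.List.Sort ≤-decTotalOrder

-- Base-level notation w.r.t. N:  a = r + N ℓ  with r ∈ {1,…,N}.
-- base N a = r  (so r = ((a - 1) mod N) + 1),  level N a = ℓ = ⌊(a - 1)/N⌋.
base : (N : ℕ) → .{{NonZero N}} → ℤ → ℕ
base N a = suc ((a - + 1) %ℕ N)

level : (N : ℕ) → .{{NonZero N}} → ℤ → ℤ
level N a = (a - + 1) /ℕ N

sumℤ : List ℤ → ℤ
sumℤ = foldr _+_ 0ℤ

window : ℕ → (ℤ → ℤ) → List ℤ
window N w = applyUpTo (λ i → w (+ suc i)) N

record IsAffinePerm (N : ℕ) (w : ℤ → ℤ) : Set where
  field
    bijective : Bijective _≡_ _≡_ w
    periodic  : ∀ x → w (x + + N) ≡ w x + + N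
    sumWindow : sumℤ (window N w) ≡ + (suc N C 2)

record IsMinCosetRep (N : ℕ) (w : ℤ → ℤ) : Set where
  field
    affinePerm : IsAffinePerm N w
    increasing : ∀ (i j : ℕ) → 1 ℕ.≤ i → i ℕ.< j → j ℕ.≤ N → w (+ i) < w (+ j)

expansionValues : (n : ℕ) → .{{NonZero n}} → (ℤ → ℤ) → ℤ → List ℤ
expansionValues n w k =
  concat (applyUpTo (λ i →
    let a = w (+ suc i) + k
        r = base n a
        ℓ = level n a
    in (+ r + + (2 ℕ.* n) * ℓ) ∷ ((+ (2 ℕ.* n ℕ.+ 1) - + r) - + (2 ℕ.* n) * ℓ) ∷ []) n)

antisymExpansion : (n : ℕ) → .{{NonZero n}} → (ℤ → ℤ) → ℤ → List ℤ
antisymExpansion n w k = ℤSort.sort (expansionValues n w k)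

Balanced : (n : ℕ) → .{{NonZero (2 ℕ.* n)}} → (ℤ → ℤ) → Set
Balanced n v = ∀ (i : ℕ) → 1 ℕ.≤ i → i ℕ.≤ n →
  (base (2 ℕ.* n) (v (+ i)) ℕ.+ base (2 ℕ.* n) (v (+ (2 ℕ.* n ℕ.+ 1 ℕ.∸ i))) ≡ 2 ℕ.* n ℕ.+ 1)
  × (level (2 ℕ.* n) (v (+ (2 ℕ.* n ℕ.+ 1 ℕ.∸ i))) ≡ - level (2 ℕ.* n) (v (+ i)))

-- Write x ↦ 2n+1−x for the mirror of Z about n+½, and w_[k](i) = r_i^{a_i}.  Since w is a
-- bijection commuting with +n, the bases r_1,…,r_n are distinct; the values r_i + 2n a_i have
-- base r_i ≤ n (mod 2n) and their mirrors have base 2n+1−r_i > n, so the 2n bases are exactly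
-- {1,…,2n}, and as each pair sums to 2n+1 the total is n(2n+1) = C(2n+1,2).  A sorted list
-- with these two properties is the window of an element of M(A_{2n-1}) (extend it periodically).
-- The value set is closed under the mirror, which reverses the order, so the sorted window
-- satisfies w̄(2n+1−i) = 2n+1−w̄(i); this is the balance.
module Submission where

open import Data.Fin as Fin using (Fin; toℕ; fromℕ<; punchOut)
import Data.Fin.Properties as FinP
open import Data.Integer as ℤ using (ℤ; +_; -[1+_]; 0ℤ; 1ℤ; _+_; _-_; _*_; -_)
open import Data.Integer.DivMod using (_%ℕ_; a≡a%ℕn+[a/ℕn]*n; n%ℕd<d)
import Data.Integer.Properties as ℤP
open import Algebra.Bundles using (AbelianGroup)
open import Algebra.Properties.Group (AbelianGroup.group ℤP.+-0-abelianGroup) using (∙-cancelˡ; ∙-cancelʳ)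
open import Data.Integer.Tactic.RingSolver using (solve-∀)
open import Data.List using (List; []; _∷_; _++_; length; map; reverse; concat; applyUpTo)
import Data.List.Properties as ListP
open import Data.List.Relation.Binary.Permutation.Propositional
  using (_↭_; swap; ↭-sym; ↭-trans; ↭-reflexive; ↭⇒↭ₛ)
import Data.List.Relation.Binary.Permutation.Propositional.Properties as PermP
import Data.List.Relation.Binary.Permutation.Setoid.Properties as PermₛP
open import Data.List.Relation.Binary.Pointwise using (Pointwise-≡⇒≡)
open import Data.List.Relation.Unary.All as All using (All; []; _∷_)
import Data.List.Relation.Unary.All.Properties as AllP
open import Data.List.Relation.Unary.AllPairs as AllPairs using (AllPairs; []; _∷_)
import Data.List.Relation.Unary.AllPairs.Properties as AllPairsP
open import Data.List.Relation.Unary.Sorted.TotalOrder ℤP.≤-totalOrder using (Sorted)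
import Data.List.Relation.Unary.Sorted.TotalOrder.Properties as SortedP
import Data.Nat
open import Data.Nat as ℕ using (ℕ; zero; suc; NonZero; z<s; s<s; s≤s)
open import Data.Nat.Combinatorics using (_C_; nCk+nC[k+1]≡[n+1]C[k+1]; nC1≡n)
import Data.Nat.Properties as ℕP
import Data.Nat.Tactic.RingSolver as ℕSolver
open import Data.Product using (∃; ∃-syntax; _×_; _,_; proj₁; proj₂)
open import Function.Base using (_∘_; _on_; flip)
open import Relation.Binary.Definitions using (tri<; tri≈; tri>)
open import Relation.Binary.PropositionalEquality
open import Relation.Nullary using (yes; no; contradiction)

open import Defs

-- Base-level arithmetic

residue : (N : ℕ) → .{{NonZero N}} → ℤ → ℕ
residue N a = (a - 1ℤ) %ℕ N

residue<N : ∀ N .{{_ : NonZero N}} x → residue N x ℕ.< N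
residue<N N x = n%ℕd<d (x - 1ℤ) N

remainder-quotient-< : ∀ {N r r′ t t′} → r ℕ.< N → t ℤ.< t′ → + r + t * + N ℤ.< + r′ + t′ * + N
remainder-quotient-< {N} {r} {r′} {t} {t′} r<N t<t′ = begin-strict
  + r + t * + N       <⟨ ℤP.+-monoˡ-< (t * + N) (ℤ.+<+ r<N) ⟩
  + N + t * + N       ≡⟨ sym (ℤP.suc-* t (+ N)) ⟩
  ℤ.suc t * + N       ≤⟨ ℤP.*-monoʳ-≤-nonNeg (+ N) (ℤP.i<j⇒suc[i]≤j t<t′) ⟩
  t′ * + N            ≤⟨ ℤP.i≤j+i (t′ * + N) (+ r′) ⟩
  + r′ + t′ * + N     ∎
  where open ℤP.≤-Reasoning

remainder-quotient-unique : ∀ {N r r′ t t′} → r ℕ.< N → r′ ℕ.< N →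
  + r + t * + N ≡ + r′ + t′ * + N → r ≡ r′ × t ≡ t′
remainder-quotient-unique {t = t} {t′} r<N r′<N eq with ℤP.<-cmp t t′
... | tri< t<t′ _ _ = contradiction eq (ℤP.<⇒≢ (remainder-quotient-< r<N t<t′))
... | tri> _ _ t>t′ = contradiction (sym eq) (ℤP.<⇒≢ (remainder-quotient-< r′<N t>t′))
... | tri≈ _ refl _ = ℤP.+-injective (∙-cancelʳ (t * + _) _ _ eq) , refl

base-level-decomposition : ∀ N .{{_ : NonZero N}} x → x ≡ + suc (residue N x) + level N x * + N
base-level-decomposition N x = begin
  x                                        ≡⟨ shift-by-one x ⟩
  1ℤ + (x - 1ℤ)                            ≡⟨ cong (_+_ 1ℤ) (a≡a%ℕn+[a/ℕn]*n (x - 1ℤ) N) ⟩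
  1ℤ + (+ residue N x + level N x * + N)   ≡⟨ ℤP.+-assoc 1ℤ (+ residue N x) (level N x * + N) ⟨
  + suc (residue N x) + level N x * + N    ∎
  where
  open ≡-Reasoning
  shift-by-one : ∀ x → x ≡ 1ℤ + (x - 1ℤ)
  shift-by-one = solve-∀

residue-level-unique : ∀ N .{{_ : NonZero N}} {x r t} → r ℕ.< N → x ≡ + suc r + t * + N →
  residue N x ≡ r × level N x ≡ t
residue-level-unique N {x} {r} {t} r<N x≡ = remainder-quotient-unique (residue<N N x) r<N (begin
  + residue N x + level N x * + N   ≡⟨ a≡a%ℕn+[a/ℕn]*n (x - 1ℤ) N ⟨
  x - 1ℤ                            ≡⟨ cong (_- 1ℤ) x≡ ⟩
  1ℤ + + r + t * + N - 1ℤ           ≡⟨ unshift (+ r) t (+ N) ⟩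
  + r + t * + N                     ∎)
  where
  open ≡-Reasoning
  unshift : ∀ r t N → 1ℤ + r + t * N - 1ℤ ≡ r + t * N
  unshift = solve-∀

residue-level-+-multiple : ∀ N .{{_ : NonZero N}} x t →
  residue N (x + t * + N) ≡ residue N x × level N (x + t * + N) ≡ level N x + t
residue-level-+-multiple N x t = residue-level-unique N (residue<N N x) (begin
  x + t * + N                                      ≡⟨ cong (_+ t * + N) (base-level-decomposition N x) ⟩
  + suc (residue N x) + level N x * + N + t * + N  ≡⟨ collect (+ suc (residue N x)) (level N x) t (+ N) ⟩
  + suc (residue N x) + (level N x + t) * + N      ∎)
  where
  open ≡-Reasoning
  collect : ∀ r ℓ t N → r + ℓ * N + t * N ≡ r + (ℓ + t) * N
  collect = solve-∀

residue-level-window : ∀ N .{{_ : NonZero N}} {i} → i ℕ.< N → residue N (+ suc i) ≡ i × level N (+ suc i) ≡ 0ℤ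
residue-level-window N i<N = residue-level-unique N {x = + suc _} {t = 0ℤ} i<N (sym (ℤP.+-identityʳ _))

residue-≡⇒+-multiple : ∀ N .{{_ : NonZero N}} {x y} → residue N x ≡ residue N y →
  y ≡ x + (level N y - level N x) * + N
residue-≡⇒+-multiple N {x} {y} same = begin
  y                                                  ≡⟨ base-level-decomposition N y ⟩
  + suc (residue N y) + level N y * + N              ≡⟨ cong (λ r → + suc r + level N y * + N) same ⟨
  + suc (residue N x) + level N y * + N              ≡⟨ regroup (+ suc (residue N x)) (level N x) (level N y) (+ N) ⟩
  (+ suc (residue N x) + level N x * + N) + (level N y - level N x) * + N
                                                     ≡⟨ cong (_+ (level N y - level N x) * + N) (base-level-decomposition N x) ⟨
  x + (level N y - level N x) * + N                  ∎
  where
  open ≡-Reasoning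
  regroup : ∀ r ℓ ℓ′ N → r + ℓ′ * N ≡ (r + ℓ * N) + (ℓ′ - ℓ) * N
  regroup = solve-∀

reflect : ℕ → ℤ → ℤ
reflect N x = + suc N - x

reflect-involutive : ∀ N x → reflect N (reflect N x) ≡ x
reflect-involutive N x = twice (+ suc N) x
  where
  twice : ∀ a x → a - (a - x) ≡ x
  twice = solve-∀

reflect-antitone : ∀ N {x y} → x ℤ.≤ y → reflect N y ℤ.≤ reflect N x
reflect-antitone N x≤y = ℤP.+-monoʳ-≤ (+ suc N) (ℤP.neg-mono-≤ x≤y)

residue-level-reflect : ∀ N .{{_ : NonZero N}} x →
  residue N (reflect N x) ≡ N ℕ.∸ suc (residue N x) × level N (reflect N x) ≡ - level N x
residue-level-reflect N x =
  residue-level-unique N (ℕP.∸-monoʳ-< z<s (residue<N N x)) (begin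
    + suc N - x                                   ≡⟨ cong (_-_ (+ suc N)) (base-level-decomposition N x) ⟩
    + suc N - (+ suc r + ℓ * + N)                 ≡⟨ mirror-sum (+ N) (+ r) ℓ ⟩
    1ℤ + (+ N - + suc r) + - ℓ * + N              ≡⟨ cong (λ d → 1ℤ + d + - ℓ * + N) N-suc-r ⟩
    1ℤ + + (N ℕ.∸ suc r) + - ℓ * + N              ∎)
  where
  open ≡-Reasoning
  r = residue N x
  ℓ = level N x
  mirror-sum : ∀ N r ℓ → (1ℤ + N) - ((1ℤ + r) + ℓ * N) ≡ 1ℤ + (N - (1ℤ + r)) + - ℓ * N
  mirror-sum = solve-∀
  N-suc-r : + N - + suc r ≡ + (N ℕ.∸ suc r)
  N-suc-r = trans (ℤP.m-n≡m⊖n N (suc r)) (ℤP.⊖-≥ (residue<N N x))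

-- Periodic functions

periodic-+-multiple : ∀ {N} {f : ℤ → ℤ} → (∀ x → f (x + + N) ≡ f x + + N) →
  ∀ x t → f (x + t * + N) ≡ f x + t * + N
periodic-+-multiple {N} {f} periodic x (+ t) = natural x t
  where
  natural : ∀ x t → f (x + + t * + N) ≡ f x + + t * + N
  natural x zero = trans (cong f (ℤP.+-identityʳ x)) (sym (ℤP.+-identityʳ (f x)))
  natural x (suc t) = begin
    f (x + (1ℤ + + t) * + N)      ≡⟨ cong f (peel x (+ t) (+ N)) ⟩
    f ((x + + t * + N) + + N)     ≡⟨ periodic (x + + t * + N) ⟩
    f (x + + t * + N) + + N       ≡⟨ cong (_+ + N) (natural x t) ⟩
    (f x + + t * + N) + + N       ≡⟨ peel (f x) (+ t) (+ N) ⟨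
    f x + (1ℤ + + t) * + N        ∎
    where
    open ≡-Reasoning
    peel : ∀ x t N → x + (1ℤ + t) * N ≡ (x + t * N) + N
    peel = solve-∀
periodic-+-multiple {N} {f} periodic x -[1+ s ] = begin
  f (x + - S * + N)                     ≡⟨ undo (f (x + - S * + N)) (S * + N) ⟩
  f (x + - S * + N) + S * + N - S * + N ≡⟨ cong (_- S * + N) (periodic-+-multiple {N} {f} periodic (x + - S * + N) S) ⟨
  f (x + - S * + N + S * + N) - S * + N ≡⟨ cong (λ y → f y - S * + N) (cancel x S (+ N)) ⟩
  f x - S * + N                         ≡⟨ negate (f x) S (+ N) ⟩
  f x + - S * + N                       ∎
  where
  open ≡-Reasoning
  S = + suc s
  undo : ∀ a b → a ≡ a + b - b
  undo = solve-∀
  cancel : ∀ x S N → x + - S * N + S * N ≡ x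
  cancel = solve-∀
  negate : ∀ a S N → a - S * N ≡ a + - S * N
  negate = solve-∀

periodic-injective⇒window-residues-injective : ∀ N .{{_ : NonZero N}} {f : ℤ → ℤ} →
  (∀ x → f (x + + N) ≡ f x + + N) → (∀ {x y} → f x ≡ f y → x ≡ y) →
  ∀ {i j} → i ℕ.< N → j ℕ.< N → residue N (f (+ suc i)) ≡ residue N (f (+ suc j)) → i ≡ j
periodic-injective⇒window-residues-injective N {f} periodic injective {i} {j} i<N j<N same = begin
  i                             ≡⟨ proj₁ (residue-level-window N i<N) ⟨
  residue N (+ suc i)           ≡⟨ proj₁ (residue-level-+-multiple N (+ suc i) T) ⟨
  residue N (+ suc i + T * + N) ≡⟨ cong (residue N) j≡i+TN ⟨
  residue N (+ suc j)           ≡⟨ proj₁ (residue-level-window N j<N) ⟩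
  j                             ∎
  where
  open ≡-Reasoning
  T = level N (f (+ suc j)) - level N (f (+ suc i))
  j≡i+TN : + suc j ≡ + suc i + T * + N
  j≡i+TN = injective (trans (residue-≡⇒+-multiple N {f (+ suc i)} same) (sym (periodic-+-multiple {N} {f} periodic (+ suc i) T)))

-- Finite and list combinatorics

Fin-injective⇒surjective : ∀ {n} {f : Fin n → Fin n} → (∀ {i j} → f i ≡ f j → i ≡ j) → ∀ c → ∃ λ i → f i ≡ c
Fin-injective⇒surjective {suc n} {f} injective c with FinP.any? (λ i → f i Fin.≟ c)
... | yes hit = hit
... | no miss = contradiction (FinP.injective⇒≤ punchOut-c-injective) ℕP.1+n≰n
  where
  avoids-c : ∀ i → c ≢ f i
  avoids-c i c≡fi = miss (i , sym c≡fi)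
  punchOut-c : Fin (suc n) → Fin n
  punchOut-c i = punchOut (avoids-c i)
  punchOut-c-injective : ∀ {i j} → punchOut-c i ≡ punchOut-c j → i ≡ j
  punchOut-c-injective {i} {j} = injective ∘ FinP.punchOut-injective (avoids-c i) (avoids-c j)

applyUpTo-cong : ∀ {A : Set} {f g : ℕ → A} n → (∀ {i} → i ℕ.< n → f i ≡ g i) → applyUpTo f n ≡ applyUpTo g n
applyUpTo-cong zero eq = refl
applyUpTo-cong (suc n) eq = cong₂ _∷_ (eq z<s) (applyUpTo-cong n (eq ∘ s<s))

-- Indexing with junk value 0 past the end; every use below is within bounds.
nth : List ℤ → ℕ → ℤ
nth [] _ = 0ℤ
nth (x ∷ xs) zero = x
nth (x ∷ xs) (suc p) = nth xs p

applyUpTo-nth : ∀ xs → applyUpTo (nth xs) (length xs) ≡ xs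
applyUpTo-nth [] = refl
applyUpTo-nth (x ∷ xs) = cong (x ∷_) (applyUpTo-nth xs)

nth-AllPairs : ∀ {R : ℤ → ℤ → Set} {xs p q} → AllPairs R xs → p ℕ.< q → q ℕ.< length xs → R (nth xs p) (nth xs q)
nth-AllPairs {R} {x ∷ xs} {zero} {suc q} (x~xs ∷ _) _ (s≤s q<) = nth-All x~xs q<
  where
  nth-All : ∀ {ys q} → All (R x) ys → q ℕ.< length ys → R x (nth ys q)
  nth-All {q = zero} (px ∷ _) _ = px
  nth-All {q = suc q} (_ ∷ pys) (s≤s q<) = nth-All pys q<
nth-AllPairs {p = suc p} {suc q} (_ ∷ pxs) (s≤s p<q) (s≤s q<) = nth-AllPairs pxs p<q q<

nth-map : ∀ f xs {q} → q ℕ.< length xs → nth (map f xs) q ≡ f (nth xs q)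
nth-map f (x ∷ xs) {zero} _ = refl
nth-map f (x ∷ xs) {suc q} (s≤s q<) = nth-map f xs q<

nth-++ˡ : ∀ xs ys {q} → q ℕ.< length xs → nth (xs ++ ys) q ≡ nth xs q
nth-++ˡ (x ∷ xs) ys {zero} _ = refl
nth-++ˡ (x ∷ xs) ys {suc q} (s≤s q<) = nth-++ˡ xs ys q<

nth-++-length : ∀ xs y ys → nth (xs ++ y ∷ ys) (length xs) ≡ y
nth-++-length [] y ys = refl
nth-++-length (x ∷ xs) y ys = nth-++-length xs y ys

nth-reverse : ∀ xs {q} → q ℕ.< length xs → nth (reverse xs) q ≡ nth xs (length xs ℕ.∸ suc q)
nth-reverse (x ∷ xs) {q} (s≤s q≤) rewrite ListP.unfold-reverse x xs with ℕP.<-cmp q (length xs)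
... | tri< q< _ _ = begin
  nth (reverse xs ++ x ∷ []) q          ≡⟨ nth-++ˡ (reverse xs) (x ∷ []) (subst (q ℕ.<_) (sym (ListP.length-reverse xs)) q<) ⟩
  nth (reverse xs) q                    ≡⟨ nth-reverse xs q< ⟩
  nth xs (length xs ℕ.∸ suc q)          ≡⟨ cong (nth (x ∷ xs)) (ℕP.+-∸-assoc 1 q<) ⟨
  nth (x ∷ xs) (suc (length xs) ℕ.∸ suc q) ∎
  where open ≡-Reasoning
... | tri≈ _ refl _ = begin
  nth (reverse xs ++ x ∷ []) (length xs)           ≡⟨ cong (nth (reverse xs ++ x ∷ [])) (ListP.length-reverse xs) ⟨
  nth (reverse xs ++ x ∷ []) (length (reverse xs)) ≡⟨ nth-++-length (reverse xs) x [] ⟩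
  x                                                ≡⟨ cong (nth (x ∷ xs)) (ℕP.n∸n≡0 (length xs)) ⟨
  nth (x ∷ xs) (length xs ℕ.∸ length xs)           ∎
  where open ≡-Reasoning
... | tri> _ _ q> = contradiction q≤ (ℕP.<⇒≱ q>)

AllPairs-reverse⁺ : ∀ {R : ℤ → ℤ → Set} {xs} → AllPairs R xs → AllPairs (flip R) (reverse xs)
AllPairs-reverse⁺ {xs = []} [] = []
AllPairs-reverse⁺ {R} {x ∷ xs} (x~xs ∷ pxs) = subst (AllPairs (flip R)) (sym (ListP.unfold-reverse x xs))
  (AllPairsP.++⁺ (AllPairs-reverse⁺ pxs) ([] ∷ [])
    (All.map (_∷ []) (PermP.All-resp-↭ (↭-sym (PermP.↭-reverse xs)) x~xs)))

sumℤ-↭ : ∀ {xs ys} → xs ↭ ys → sumℤ xs ≡ sumℤ ys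
sumℤ-↭ p = PermₛP.foldr-commMonoid (setoid ℤ) ℤP.+-0-isCommutativeMonoid (↭⇒↭ₛ p)

↭-sorted-unique : ∀ {xs ys} → Sorted xs → Sorted ys → xs ↭ ys → xs ≡ ys
↭-sorted-unique xs↗ ys↗ xs↭ys = Pointwise-≡⇒≡ (SortedP.↗↭↗⇒≋ ℤP.≤-totalOrder xs↗ ys↗ (↭⇒↭ₛ xs↭ys))

sorted-reflect-symmetric : ∀ N {xs} → Sorted xs → map (reflect N) (reverse xs) ↭ xs →
  ∀ {p} → p ℕ.< length xs → nth xs (length xs ℕ.∸ suc p) ≡ reflect N (nth xs p)
sorted-reflect-symmetric N {xs} xs↗ closed {p} p< = begin
  nth xs (length xs ℕ.∸ suc p)                          ≡⟨ reflect-involutive N _ ⟨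
  reflect N (reflect N (nth xs (length xs ℕ.∸ suc p)))  ≡⟨ cong (reflect N ∘ reflect N) (nth-reverse xs p<) ⟨
  reflect N (reflect N (nth (reverse xs) p))            ≡⟨ cong (reflect N) (nth-map (reflect N) (reverse xs) p<ʳ) ⟨
  reflect N (nth (map (reflect N) (reverse xs)) p)      ≡⟨ cong (λ ys → reflect N (nth ys p)) mirror≡xs ⟩
  reflect N (nth xs p)                                  ∎
  where
  open ≡-Reasoning
  p<ʳ : p ℕ.< length (reverse xs)
  p<ʳ = subst (p ℕ.<_) (sym (ListP.length-reverse xs)) p<
  mirror↗ : Sorted (map (reflect N) (reverse xs))
  mirror↗ = SortedP.AllPairs⇒Sorted ℤP.≤-totalOrder
    (AllPairsP.map⁺ (AllPairs-reverse⁺ (AllPairs.map (reflect-antitone N)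
      (SortedP.Sorted⇒AllPairs ℤP.≤-totalOrder xs↗))))
  mirror≡xs : map (reflect N) (reverse xs) ≡ xs
  mirror≡xs = ↭-sorted-unique mirror↗ xs↗ closed

2*[1+n]C2≡[1+n]*n : ∀ n → 2 ℕ.* (suc n C 2) ≡ suc n ℕ.* n
2*[1+n]C2≡[1+n]*n zero = refl
2*[1+n]C2≡[1+n]*n (suc n) = begin
  2 ℕ.* (suc (suc n) C 2)                   ≡⟨ cong (2 ℕ.*_) (nCk+nC[k+1]≡[n+1]C[k+1] (suc n) 1) ⟨
  2 ℕ.* (suc n C 1 ℕ.+ suc n C 2)           ≡⟨ cong (λ c → 2 ℕ.* (c ℕ.+ suc n C 2)) (nC1≡n (suc n)) ⟩
  2 ℕ.* (suc n ℕ.+ suc n C 2)               ≡⟨ ℕP.*-distribˡ-+ 2 (suc n) _ ⟩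
  2 ℕ.* suc n ℕ.+ 2 ℕ.* (suc n C 2)         ≡⟨ cong (2 ℕ.* suc n ℕ.+_) (2*[1+n]C2≡[1+n]*n n) ⟩
  2 ℕ.* suc n ℕ.+ suc n ℕ.* n               ≡⟨ expand n ⟩
  suc (suc n) ℕ.* suc n                     ∎
  where
  open ≡-Reasoning
  expand : ∀ n → 2 ℕ.* suc n ℕ.+ suc n ℕ.* n ≡ suc (suc n) ℕ.* suc n
  expand = ℕSolver.solve-∀

[1+2n]C2≡n*[1+2n] : ∀ n → suc (2 ℕ.* n) C 2 ≡ n ℕ.* suc (2 ℕ.* n)
[1+2n]C2≡n*[1+2n] n = ℕP.*-cancelˡ-≡ _ _ 2 (trans (2*[1+n]C2≡[1+n]*n (2 ℕ.* n)) (reassociate n))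
  where
  reassociate : ∀ n → suc (2 ℕ.* n) ℕ.* (2 ℕ.* n) ≡ 2 ℕ.* (n ℕ.* suc (2 ℕ.* n))
  reassociate = ℕSolver.solve-∀

-- The affine permutation with a given window

module FromWindow (N : ℕ) .{{_ : NonZero N}} (L : List ℤ) (length-L : length L ≡ N) (L↗ : Sorted L)
                  (L-residues-distinct : AllPairs (_≢_ on residue N) L) where

  slot : ℕ → ℕ
  slot p = residue N (nth L p)

  p<length-L : ∀ {p} → p ℕ.< N → p ℕ.< length L
  p<length-L = subst (_ ℕ.<_) (sym length-L)

  slot-injective : ∀ {p q} → p ℕ.< N → q ℕ.< N → slot p ≡ slot q → p ≡ q
  slot-injective {p} {q} p<N q<N same with ℕP.<-cmp p q
  ... | tri< p<q _ _ = contradiction same (nth-AllPairs L-residues-distinct p<q (p<length-L q<N))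
  ... | tri≈ _ p≡q _ = p≡q
  ... | tri> _ _ p>q = contradiction (sym same) (nth-AllPairs L-residues-distinct p>q (p<length-L p<N))

  slot-surjective : ∀ {c} → c ℕ.< N → ∃[ p ] (p ℕ.< N × slot p ≡ c)
  slot-surjective {c} c<N = toℕ i , FinP.toℕ<n i , slot-i≡c
    where
    open ≡-Reasoning
    slot<N : ∀ p → slot p ℕ.< N
    slot<N p = residue<N N (nth L p)
    slotFin : Fin N → Fin N
    slotFin i = fromℕ< (slot<N (toℕ i))
    slotFin-injective : ∀ {i j} → slotFin i ≡ slotFin j → i ≡ j
    slotFin-injective {i} {j} eq = FinP.toℕ-injective (slot-injective (FinP.toℕ<n i) (FinP.toℕ<n j)
      (trans (sym (FinP.toℕ-fromℕ< (slot<N (toℕ i)))) (trans (cong toℕ eq) (FinP.toℕ-fromℕ< (slot<N (toℕ j))))))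
    i = proj₁ (Fin-injective⇒surjective slotFin-injective (fromℕ< c<N))
    hit = proj₂ (Fin-injective⇒surjective slotFin-injective (fromℕ< c<N))
    slot-i≡c : slot (toℕ i) ≡ c
    slot-i≡c = begin
      slot (toℕ i)         ≡⟨ FinP.toℕ-fromℕ< (slot<N (toℕ i)) ⟨
      toℕ (slotFin i)      ≡⟨ cong toℕ hit ⟩
      toℕ (fromℕ< c<N)     ≡⟨ FinP.toℕ-fromℕ< c<N ⟩
      c                    ∎

  fromWindow : ℤ → ℤ
  fromWindow x = nth L (residue N x) + level N x * + N

  fromWindow-window : ∀ {i} → i ℕ.< N → fromWindow (+ suc i) ≡ nth L i
  fromWindow-window {i} i<N = trans (cong₂ (λ r ℓ → nth L r + ℓ * + N) residue≡ level≡) (ℤP.+-identityʳ (nth L i))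
    where
    residue≡ = proj₁ (residue-level-window N i<N)
    level≡ = proj₂ (residue-level-window N i<N)

  window-fromWindow : window N fromWindow ≡ L
  window-fromWindow = begin
    applyUpTo (λ i → fromWindow (+ suc i)) N  ≡⟨ applyUpTo-cong N fromWindow-window ⟩
    applyUpTo (nth L) N                       ≡⟨ cong (applyUpTo (nth L)) length-L ⟨
    applyUpTo (nth L) (length L)              ≡⟨ applyUpTo-nth L ⟩
    L                                         ∎
    where open ≡-Reasoning

  fromWindow-periodic : ∀ x → fromWindow (x + + N) ≡ fromWindow x + + N
  fromWindow-periodic x = begin
    fromWindow (x + + N)                               ≡⟨ cong fromWindow (cong (_+_ x) (ℤP.*-identityˡ (+ N))) ⟨
    fromWindow (x + 1ℤ * + N)                          ≡⟨ cong₂ (λ r ℓ → nth L r + ℓ * + N) residue≡ level≡ ⟩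
    nth L (residue N x) + (level N x + 1ℤ) * + N       ≡⟨ split (nth L (residue N x)) (level N x) (+ N) ⟩
    fromWindow x + + N                                 ∎
    where
    open ≡-Reasoning
    residue≡ = proj₁ (residue-level-+-multiple N x 1ℤ)
    level≡ = proj₂ (residue-level-+-multiple N x 1ℤ)
    split : ∀ a ℓ N → a + (ℓ + 1ℤ) * N ≡ a + ℓ * N + N
    split = solve-∀

  residue-fromWindow : ∀ x → residue N (fromWindow x) ≡ slot (residue N x)
  residue-fromWindow x = proj₁ (residue-level-+-multiple N (nth L (residue N x)) (level N x))

  fromWindow-injective : ∀ {x y} → fromWindow x ≡ fromWindow y → x ≡ y
  fromWindow-injective {x} {y} eq = begin
    x                                        ≡⟨ base-level-decomposition N x ⟩
    + suc (residue N x) + level N x * + N    ≡⟨ cong₂ (λ r ℓ → + suc r + ℓ * + N) residue≡ level≡ ⟩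
    + suc (residue N y) + level N y * + N    ≡⟨ base-level-decomposition N y ⟨
    y                                        ∎
    where
    open ≡-Reasoning
    residue≡ : residue N x ≡ residue N y
    residue≡ = slot-injective (residue<N N x) (residue<N N y)
      (trans (sym (residue-fromWindow x)) (trans (cong (residue N) eq) (residue-fromWindow y)))
    level≡ : level N x ≡ level N y
    level≡ = ℤP.*-cancelʳ-≡ _ _ (+ N) (∙-cancelˡ (nth L (residue N x)) _ _
      (trans eq (cong (λ r → nth L r + level N y * + N) (sym residue≡))))

  fromWindow-surjective : ∀ y → ∃ λ x → ∀ {z} → z ≡ x → fromWindow z ≡ y
  fromWindow-surjective y = x , λ { refl → fromWindow-x }
    where
    open ≡-Reasoning
    hit = slot-surjective (residue<N N y)
    p = proj₁ hit
    ℓ = level N (nth L p)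
    T = level N y - ℓ
    x = + suc p + T * + N
    x-base-level : residue N x ≡ p × level N x ≡ T
    x-base-level = residue-level-unique N (proj₁ (proj₂ hit)) refl
    shift : ∀ r ℓ ℓ′ N → r + ℓ * N + (ℓ′ - ℓ) * N ≡ r + ℓ′ * N
    shift = solve-∀
    fromWindow-x : fromWindow x ≡ y
    fromWindow-x = begin
      nth L (residue N x) + level N x * + N        ≡⟨ cong₂ (λ r t → nth L r + t * + N) (proj₁ x-base-level) (proj₂ x-base-level) ⟩
      nth L p + T * + N                            ≡⟨ cong (_+ T * + N) (base-level-decomposition N (nth L p)) ⟩
      + suc (slot p) + ℓ * + N + T * + N           ≡⟨ cong (λ r → + suc r + ℓ * + N + T * + N) (proj₂ (proj₂ hit)) ⟩
      + suc (residue N y) + ℓ * + N + T * + N      ≡⟨ shift (+ suc (residue N y)) ℓ (level N y) (+ N) ⟩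
      + suc (residue N y) + level N y * + N        ≡⟨ base-level-decomposition N y ⟨
      y                                            ∎

  fromWindow-increasing : ∀ i j → 1 ℕ.≤ i → i ℕ.< j → j ℕ.≤ N → fromWindow (+ i) ℤ.< fromWindow (+ j)
  fromWindow-increasing (suc i) (suc j) _ (s≤s i<j) j≤N =
    subst₂ ℤ._<_ (sym (fromWindow-window i<N)) (sym (fromWindow-window j≤N))
      (ℤP.≤∧≢⇒< (nth-AllPairs (SortedP.Sorted⇒AllPairs ℤP.≤-totalOrder L↗) i<j (p<length-L j≤N))
                λ eq → ℕP.<⇒≢ i<j (slot-injective i<N j≤N (cong (residue N) eq)))
    where
    i<N = ℕP.<-trans i<j j≤N

  fromWindow-isMinCosetRep : sumℤ L ≡ + (suc N C 2) → IsMinCosetRep N fromWindow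
  fromWindow-isMinCosetRep sum-L = record
    { affinePerm = record
      { bijective = fromWindow-injective , fromWindow-surjective
      ; periodic = fromWindow-periodic
      ; sumWindow = trans (cong sumℤ window-fromWindow) sum-L
      }
    ; increasing = fromWindow-increasing
    }

-- Lists closed under the mirror

mirror : ℕ → List ℤ → List ℤ
mirror N [] = []
mirror N (x ∷ xs) = x ∷ reflect N x ∷ mirror N xs

length-mirror : ∀ N xs → length (mirror N xs) ≡ 2 ℕ.* length xs
length-mirror N [] = refl
length-mirror N (x ∷ xs) = trans (cong (suc ∘ suc) (length-mirror N xs)) (double-suc (length xs))
  where
  double-suc : ∀ n → suc (suc (2 ℕ.* n)) ≡ 2 ℕ.* suc n
  double-suc = ℕSolver.solve-∀

sumℤ-mirror : ∀ N xs → sumℤ (mirror N xs) ≡ + length xs * + suc N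
sumℤ-mirror N [] = refl
sumℤ-mirror N (x ∷ xs) = trans (cong (λ s → x + (reflect N x + s)) (sumℤ-mirror N xs))
                               (pair-sum x (+ length xs) (+ N))
  where
  pair-sum : ∀ x n N → x + ((1ℤ + N - x) + n * (1ℤ + N)) ≡ (1ℤ + n) * (1ℤ + N)
  pair-sum = solve-∀

map-reflect-mirror : ∀ N xs → map (reflect N) (mirror N xs) ↭ mirror N xs
map-reflect-mirror N [] = ↭-reflexive refl
map-reflect-mirror N (x ∷ xs) = subst (λ y → reflect N x ∷ y ∷ map (reflect N) (mirror N xs) ↭ mirror N (x ∷ xs))
  (sym (reflect-involutive N x)) (swap (reflect N x) x (map-reflect-mirror N xs))

concat-pairs≡mirror : ∀ N {f h : ℕ → ℤ} n → (∀ i → h i ≡ reflect N (f i)) →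
  concat (applyUpTo (λ i → f i ∷ h i ∷ []) n) ≡ mirror N (applyUpTo f n)
concat-pairs≡mirror N zero h≡ = refl
concat-pairs≡mirror N (suc n) h≡ =
  cong₂ (λ y ys → _ ∷ y ∷ ys) (h≡ 0) (concat-pairs≡mirror N n (h≡ ∘ suc))

All-mirror⁺ : ∀ N {P : ℤ → Set} {xs} → All P xs → All (P ∘ reflect N) xs → All P (mirror N xs)
All-mirror⁺ N [] [] = []
All-mirror⁺ N (px ∷ pxs) (prx ∷ prxs) = px ∷ prx ∷ All-mirror⁺ N pxs prxs

module MirrorResidues (N : ℕ) .{{_ : NonZero N}} (n : ℕ) (n+n≤N : n ℕ.+ n ℕ.≤ N) where

  Low : ℤ → Set
  Low x = residue N x ℕ.< n

  Distinct : ℤ → ℤ → Set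
  Distinct = _≢_ on residue N

  reflect-low-high : ∀ {x} → Low x → n ℕ.≤ residue N (reflect N x)
  reflect-low-high {x} x-low = subst (n ℕ.≤_) (sym (proj₁ (residue-level-reflect N x)))
    (ℕP.m+n≤o⇒m≤o∸n n (ℕP.≤-trans (ℕP.+-monoʳ-≤ n x-low) n+n≤N))

  low-distinct-reflect : ∀ {x y} → Low x → Low y → Distinct x (reflect N y)
  low-distinct-reflect {x} {y} x-low y-low same = ℕP.<⇒≱ x-low (subst (n ℕ.≤_) (sym same) (reflect-low-high {y} y-low))

  reflect-distinct : ∀ {x y} → Distinct x y → Distinct (reflect N x) (reflect N y)
  reflect-distinct {x} {y} x≁y same = x≁y (ℕP.suc-injective (ℕP.∸-cancelˡ-≡ (residue<N N x) (residue<N N y)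
    (trans (sym (proj₁ (residue-level-reflect N x))) (trans same (proj₁ (residue-level-reflect N y))))))

  mirror-residues-distinct : ∀ {xs} → All Low xs → AllPairs Distinct xs → AllPairs Distinct (mirror N xs)
  mirror-residues-distinct {x ∷ xs} (x-low ∷ xs-low) (x≁xs ∷ xs-distinct) =
      (low-distinct-reflect {x} {x} x-low x-low ∷
        All-mirror⁺ N x≁xs (All.map (λ {y} → low-distinct-reflect {x} {y} x-low) xs-low))
    ∷ All-mirror⁺ N (All.map (λ {y} y-low same → low-distinct-reflect {y} {x} y-low x-low (sym same)) xs-low)
                    (All.map (λ {y} → reflect-distinct {x} {y}) x≁xs)
    ∷ mirror-residues-distinct xs-low xs-distinct
  mirror-residues-distinct {[]} [] [] = []

balanced-if-reflect-symmetric : ∀ n .{{_ : NonZero (2 ℕ.* n)}} (v : ℤ → ℤ) →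
  (∀ {i} → 1 ℕ.≤ i → i ℕ.≤ n → v (+ (2 ℕ.* n ℕ.+ 1 ℕ.∸ i)) ≡ reflect (2 ℕ.* n) (v (+ i))) → Balanced n v
balanced-if-reflect-symmetric n v symmetric i 1≤i i≤n rewrite symmetric 1≤i i≤n = base-sum , level-reflect
  where
  N = 2 ℕ.* n
  r = residue N (v (+ i))
  level-reflect = proj₂ (residue-level-reflect N (v (+ i)))
  base-sum : suc r ℕ.+ suc (residue N (reflect N (v (+ i)))) ≡ N ℕ.+ 1
  base-sum = begin
    suc r ℕ.+ suc (residue N (reflect N (v (+ i))))   ≡⟨ cong (λ s → suc r ℕ.+ suc s) (proj₁ (residue-level-reflect N (v (+ i)))) ⟩
    suc r ℕ.+ suc (N ℕ.∸ suc r)                       ≡⟨ ℕP.+-suc (suc r) _ ⟩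
    suc (suc r ℕ.+ (N ℕ.∸ suc r))                     ≡⟨ cong suc (ℕP.m+[n∸m]≡n (residue<N N (v (+ i)))) ⟩
    suc N                                             ≡⟨ ℕP.+-comm 1 N ⟩
    N ℕ.+ 1                                           ∎
    where open ≡-Reasoning

-- The antisymmetric expansion

module Expansion (m : ℕ) (w : ℤ → ℤ) (w-minimal : IsMinCosetRep (suc m) w) (k : ℤ) where
  open IsMinCosetRep w-minimal
  open IsAffinePerm affinePerm

  n = suc m
  N = 2 ℕ.* n

  n+n≤N : n ℕ.+ n ℕ.≤ N
  n+n≤N = ℕP.≤-reflexive (cong (n ℕ.+_) (sym (ℕP.+-identityʳ n)))

  shifted : ℤ → ℤ
  shifted x = w x + k

  shifted-periodic : ∀ x → shifted (x + + n) ≡ shifted x + + n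
  shifted-periodic x = trans (cong (_+ k) (periodic x)) (swap-k (w x) (+ n) k)
    where
    swap-k : ∀ a n k → a + n + k ≡ a + k + n
    swap-k = solve-∀

  shifted-injective : ∀ {x y} → shifted x ≡ shifted y → x ≡ y
  shifted-injective {x} {y} eq = proj₁ bijective (∙-cancelʳ k _ _ eq)

  a : ℕ → ℤ
  a i = shifted (+ suc i)

  expanded : ℕ → ℤ
  expanded i = + base n (a i) + + N * level n (a i)

  expansionValues≡mirror : expansionValues n w k ≡ mirror N (applyUpTo expanded n)
  expansionValues≡mirror = concat-pairs≡mirror N {f = expanded} n second≡reflect
    where
    regroup : ∀ M b x → (M - b) - x ≡ M - (b + x)
    regroup = solve-∀
    second≡reflect : ∀ i → (+ (N ℕ.+ 1) - + base n (a i)) - + N * level n (a i) ≡ reflect N (expanded i)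
    second≡reflect i = trans (cong (λ M → (+ M - + base n (a i)) - + N * level n (a i)) (ℕP.+-comm N 1))
                             (regroup (+ suc N) (+ base n (a i)) (+ N * level n (a i)))

  residue-expanded : ∀ i → residue N (expanded i) ≡ residue n (a i)
  residue-expanded i = proj₁ (residue-level-unique N {t = level n (a i)} (ℕP.<-≤-trans (residue<N n (a i)) (ℕP.m≤m+n n _))
    (cong (_+_ (+ base n (a i))) (ℤP.*-comm (+ N) (level n (a i)))))

  open MirrorResidues N n n+n≤N

  expanded-low : All Low (applyUpTo expanded n)
  expanded-low = AllP.applyUpTo⁺₁ expanded n λ {i} _ → subst (ℕ._< n) (sym (residue-expanded i)) (residue<N n (a i))

  expanded-distinct : AllPairs Distinct (applyUpTo expanded n)
  expanded-distinct = AllPairsP.applyUpTo⁺₁ expanded n λ {i} {j} i<j j<n same → ℕP.<⇒≢ i<j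
    (periodic-injective⇒window-residues-injective n shifted-periodic shifted-injective (ℕP.<-trans i<j j<n) j<n
      (trans (sym (residue-expanded i)) (trans same (residue-expanded j))))

  L = ℤSort.sort (expansionValues n w k)

  L↭mirror : L ↭ mirror N (applyUpTo expanded n)
  L↭mirror = ↭-trans (ℤSort.sort-↭ _) (↭-reflexive expansionValues≡mirror)

  length-L : length L ≡ N
  length-L = trans (PermP.↭-length L↭mirror)
                   (trans (length-mirror N (applyUpTo expanded n)) (cong (2 ℕ.*_) (ListP.length-applyUpTo expanded n)))

  L-residues-distinct : AllPairs Distinct L
  L-residues-distinct = PermₛP.AllPairs-resp-↭ (setoid ℤ) (_∘ sym) (resp₂ Distinct) (↭⇒↭ₛ (↭-sym L↭mirror))
    (mirror-residues-distinct expanded-low expanded-distinct)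

  sum-L : sumℤ L ≡ + (suc N C 2)
  sum-L = begin
    sumℤ L                                               ≡⟨ sumℤ-↭ L↭mirror ⟩
    sumℤ (mirror N (applyUpTo expanded n))               ≡⟨ sumℤ-mirror N (applyUpTo expanded n) ⟩
    + length (applyUpTo expanded n) * + suc N            ≡⟨ cong (λ l → + l * + suc N) (ListP.length-applyUpTo expanded n) ⟩
    + n * + suc N                                        ≡⟨ ℤP.pos-* n (suc N) ⟨
    + (n ℕ.* suc N)                                      ≡⟨ cong +_ ([1+2n]C2≡n*[1+2n] n) ⟨
    + (suc N C 2)                                        ∎
    where open ≡-Reasoning

  L-reflect-closed : map (reflect N) (reverse L) ↭ L
  L-reflect-closed = ↭-trans (PermP.map⁺ (reflect N) (↭-trans (PermP.↭-reverse L) L↭mirror))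
                             (↭-trans (map-reflect-mirror N (applyUpTo expanded n)) (↭-sym L↭mirror))

  open FromWindow N L length-L (ℤSort.sort-↗ _) L-residues-distinct public

  fromWindow-balanced : Balanced n fromWindow
  fromWindow-balanced = balanced-if-reflect-symmetric n fromWindow symmetric
    where
    symmetric : ∀ {i} → 1 ℕ.≤ i → i ℕ.≤ n → fromWindow (+ (N ℕ.+ 1 ℕ.∸ i)) ≡ reflect N (fromWindow (+ i))
    symmetric {suc i} _ i<n = begin
      fromWindow (+ (N ℕ.+ 1 ℕ.∸ suc i))        ≡⟨ cong (λ j → fromWindow (+ j)) mirror-index ⟩
      fromWindow (+ suc (N ℕ.∸ suc i))          ≡⟨ fromWindow-window (ℕP.∸-monoʳ-< z<s i<N) ⟩
      nth L (N ℕ.∸ suc i)                       ≡⟨ cong (λ l → nth L (l ℕ.∸ suc i)) length-L ⟨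
      nth L (length L ℕ.∸ suc i)                ≡⟨ sorted-reflect-symmetric N (ℤSort.sort-↗ _) L-reflect-closed (p<length-L i<N) ⟩
      reflect N (nth L i)                       ≡⟨ cong (reflect N) (fromWindow-window i<N) ⟨
      reflect N (fromWindow (+ suc i))          ∎
      where
      open ≡-Reasoning
      i<N = ℕP.<-≤-trans i<n (ℕP.m≤m+n n _)
      mirror-index : N ℕ.+ 1 ℕ.∸ suc i ≡ suc (N ℕ.∸ suc i)
      mirror-index = trans (cong (ℕ._∸ suc i) (ℕP.+-comm N 1)) (ℕP.+-∸-assoc 1 i<N)

lemma2p10 : (m : ℕ) (w : ℤ → ℤ) → IsMinCosetRep (suc m) w → (k : ℤ) →
    ∃[ wb ] (IsMinCosetRep (2 Data.Nat.* suc m) wb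
             × window (2 Data.Nat.* suc m) wb ≡ antisymExpansion (suc m) w k
             × Balanced (suc m) wb)
lemma2p10 m w w-minimal k = fromWindow , fromWindow-isMinCosetRep sum-L , window-fromWindow , fromWindow-balanced
  where open Expansion m w w-minimal k
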